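{- Let $\mathcal{T}$ be a type system, $\mathtt{Ag}$ a set of agents, and $\mathbb{C}$ a finite set of negative constraints over $\mathcal{T}$ and $\mathtt{Ag}$. Let $\mathcal{B}$ be an architecture over $\mathcal{T}_{\mathbb{C}}$ with set of agents $\mathtt{Ag}'$, where $\mathtt{Ag} \subseteq \mathtt{Ag}'$. Suppose there is a partition $\{\mathcal{P}_\alpha\}_{\alpha \in \mathtt{Ag}}$ of $\mathtt{Ag}'$ indexed by $\mathtt{Ag}$ such that: (1) $\alpha \in \mathcal{P}_\alpha$ for all $\alpha \in \mathtt{Ag}$; (2) if $A \in M_{\beta\beta'}$ and $\beta, \beta'$ lie in different sets of the partition, then $A$ has the form $C_\gamma(B)$ for some $\gamma, B$; (3) if $\pi_{\alpha A} \in H_\beta$ then $\beta \in \mathcal{P}_\alpha$; (4) for every constraint $\alpha \ni A \Rightarrow B$ in $\mathbb{C}$, if an agent $\beta \in \mathcal{P}_\alpha$ possesses (i.e. has in $H_\beta$) a constructor with target $A$, then this constructor is $\pi_{\alpha A}$. Then every valid trace through $\mathcal{B}$ complies with every negative constraint in $\mathbb{C}$.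
   Context: A type system consists of a set of atomic types (types generated from atomic types by $\rightarrow$) and a set of constructors, each with a type. Terms: each constructor of type $A$ is a term of type $A$; if $s : A \rightarrow B$ and $t : A$ then $st : B$. A constructor of type $B_1 \rightarrow \cdots \rightarrow B_n \rightarrow A$ ($n\ge0$, $A$ atomic) has target $A$. An architecture over a type system consists of a set of agents; for each agent $\alpha$ a set $H_\alpha$ of constructors ($\alpha$ initially possesses them); for each ordered pair of distinct agents $(\alpha,\beta)$ a set $M_{\alpha\beta}$ of atomic types. An event is $\alpha \stackrel{t : A}{\rightarrow} \beta$; a trace is a finite sequence of events; $\tau_1 \sqsubseteq \tau$ means $\tau_1$ is a prefix of $\tau$. Judgements $\tau \vdash \alpha \ni t:A$ are derived by: (init) if $c:A \in H_\alpha$ then $\vdash \alpha \ni c : A$ (empty trace); (message$_1$) if $\tau \vdash \alpha \ni t : A$ and $A \in M_{\alpha\beta}$ then $\tau, (\alpha \stackrel{t:A}{\rightarrow} \beta) \vdash \beta \ni t : A$; (message$_2$) if $\tau \vdash \alpha \ni t : A$, $A \in M_{\alpha\beta}$ and $\tau \vdash \gamma \ni s : C$ then $\tau, (\alpha \stackrel{t:A}{\rightarrow} \beta) \vdash \gamma \ni s : C$; (func) if $\tau \vdash \alpha \ni f : A \rightarrow B$ and $\tau \vdash \alpha \ni t : A$ then $\tau \vdash \alpha \ni ft : B$. A trace is valid iff some judgement with that trace is derivable. $\tau \vdash \alpha \ni A$ means $\tau \vdash \alpha \ni t:A$ for some $t$; $\tau \vdash A$ means $\tau \vdash \alpha \ni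 t:A$ for some $\alpha, t$. A negative constraint over $\mathcal{T}$ and $\mathtt{Ag}$ has the form $\alpha \ni A \Rightarrow B$ with $\alpha \in \mathtt{Ag}$ and $A, B$ atomic types of $\mathcal{T}$; a trace $\tau$ complies with it iff for every $\tau_1 \sqsubseteq \tau$, if $\tau_1 \vdash \alpha \ni A$ then $\tau_1 \vdash B$. The type system $\mathcal{T}_{\mathbb{C}}$: its atomic types are those of $\mathcal{T}$ together with a new atomic type $C_\alpha(A)$ for each $\alpha \in \mathtt{Ag}$ and atomic type $A$ of $\mathcal{T}$; its constructors are those of $\mathcal{T}$ together with, for each $\alpha \in \mathtt{Ag}$ and atomic type $A$ of $\mathcal{T}$, writing the constraints of $\mathbb{C}$ beginning with $\alpha \ni A$ as $\alpha \ni A \Rightarrow B_1, \ldots, \alpha \ni A \Rightarrow B_n$ ($n \ge 0$): constructors $m_{\alpha A}^{\beta_1 \cdots \beta_n} : A \rightarrow C_{\beta_1}(B_1) \rightarrow \cdots \rightarrow C_{\beta_n}(B_n) \rightarrow C_\alpha(A)$ for all $\beta_1, \ldots, \beta_n \in \mathtt{Ag}$, and $\pi_{\alpha A} : C_\alpha(A) \rightarrow A$. -}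

module Defs where

open import Data.List using (List; []; _∷_; _++_; [_]; length)
open import Data.List.Membership.Propositional using (_∈_)
open import Data.Vec as Vec using (Vec)
open import Data.Product using (Σ; ∃; _×_; _,_)
open import Data.Sum using (_⊎_; inj₁; inj₂)
open import Relation.Binary.PropositionalEquality using (_≡_; _≢_)
open import Relation.Nullary using (¬_)

infixr 5 _⇒_
data Ty (At : Set) : Set where
  atom : At → Ty At
  _⇒_  : Ty At → Ty At → Ty At

target : {At : Set} → Ty At → At
target (atom A) = A
target (_ ⇒ B)  = target B

record TypeSystem : Set₁ where
  field
    At    : Set
    Con   : Set
    conTy : Con → Ty At
open TypeSystem public

data Tm (S : TypeSystem) : Ty (At S) → Set where
  con : (c : Con S) → Tm S (conTy S c)
  app : {A B : Ty (At S)} → Tm S (A ⇒ B) → Tm S A → Tm S B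

record Architecture (S : TypeSystem) (Agent : Set) : Set₁ where
  field
    H : Agent → Con S → Set
    M : Agent → Agent → At S → Set     -- A ∈ M α β (used only for α ≢ β)
open Architecture public

record Event (S : TypeSystem) (Agent : Set) : Set where
  constructor ev
  field
    sender   : Agent
    receiver : Agent
    ty       : At S
    term     : Tm S (atom ty)

Trace : TypeSystem → Set → Set
Trace S Agent = List (Event S Agent)

_⊑_ : {S : TypeSystem} {Agent : Set} → Trace S Agent → Trace S Agent → Set
τ₁ ⊑ τ = ∃ λ τ₂ → τ₁ ++ τ₂ ≡ τ

module Judgement {S : TypeSystem} {Agent : Set} (𝓑 : Architecture S Agent) where

  data _⊢_∋_ : Trace S Agent → Agent → {A : Ty (At S)} → Tm S A → Set where
    init     : ∀ {α c} → H 𝓑 α c → [] ⊢ α ∋ con c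
    message₁ : ∀ {τ α β A} {t : Tm S (atom A)} →
               τ ⊢ α ∋ t → α ≢ β → M 𝓑 α β A →
               (τ ++ [ ev α β A t ]) ⊢ β ∋ t
    message₂ : ∀ {τ α β γ A C} {t : Tm S (atom A)} {s : Tm S C} →
               τ ⊢ α ∋ t → α ≢ β → M 𝓑 α β A → τ ⊢ γ ∋ s →
               (τ ++ [ ev α β A t ]) ⊢ γ ∋ s
    func     : ∀ {τ α A B} {f : Tm S (A ⇒ B)} {t : Tm S A} →
               τ ⊢ α ∋ f → τ ⊢ α ∋ t → τ ⊢ α ∋ app f t

  Valid : Trace S Agent → Set
  Valid τ = Σ Agent λ α → Σ (Ty (At S)) λ A → Σ (Tm S A) λ t → τ ⊢ α ∋ t

  _⊢_∋ᵀ_ : Trace S Agent → Agent → Ty (At S) → Set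
  τ ⊢ α ∋ᵀ A = Σ (Tm S A) λ t → τ ⊢ α ∋ t

  _⊢ᵀ_ : Trace S Agent → Ty (At S) → Set
  τ ⊢ᵀ A = Σ Agent λ α → τ ⊢ α ∋ᵀ A

record NegConstraint (Ag At : Set) : Set where
  constructor _∋_⇒_
  field
    agent : Ag
    lhs   : At
    rhs   : At
open NegConstraint public

data Select {Ag At : Set} (α : Ag) (A : At) :
            List (NegConstraint Ag At) → List At → Set where
  done : Select α A [] []
  keep : ∀ {ℂ Bs B} → Select α A ℂ Bs →
         Select α A ((α ∋ A ⇒ B) ∷ ℂ) (B ∷ Bs)
  skip : ∀ {ℂ Bs κ} → ¬ (agent κ ≡ α × lhs κ ≡ A) → Select α A ℂ Bs →
         Select α A (κ ∷ ℂ) Bs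

module Extended (𝒯 : TypeSystem) (Ag : Set) (ℂ : List (NegConstraint Ag (At 𝒯))) where

  -- atomic types: inj₁ A  (old),   inj₂ (α , A) = C_α(A)
  AtC : Set
  AtC = At 𝒯 ⊎ (Ag × At 𝒯)

  Cty : Ag → At 𝒯 → Ty AtC
  Cty α A = atom (inj₂ (α , A))

  liftTy : Ty (At 𝒯) → Ty AtC
  liftTy (atom A) = atom (inj₁ A)
  liftTy (A ⇒ B)  = liftTy A ⇒ liftTy B

  mArgs : (Bs : List (At 𝒯)) → Vec Ag (length Bs) → Ty AtC → Ty AtC
  mArgs []       Vec.[]         R = R
  mArgs (B ∷ Bs) (β Vec.∷ βs)   R = Cty β B ⇒ mArgs Bs βs R

  data ConC : Set where
    old : Con 𝒯 → ConC
    m   : (α : Ag) (A : At 𝒯) (Bs : List (At 𝒯)) → Select α A ℂ Bs →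
          Vec Ag (length Bs) → ConC
    π   : Ag → At 𝒯 → ConC

  conTyC : ConC → Ty AtC
  conTyC (old c)          = liftTy (conTy 𝒯 c)
  conTyC (m α A Bs _ βs)  = atom (inj₁ A) ⇒ mArgs Bs βs (Cty α A)
  conTyC (π α A)          = Cty α A ⇒ atom (inj₁ A)

  𝒯ℂ : TypeSystem
  𝒯ℂ = record { At = AtC ; Con = ConC ; conTy = conTyC }

  Complies : {Agent : Set} (𝓑 : Architecture 𝒯ℂ Agent) (emb : Ag → Agent) →
             Trace 𝒯ℂ Agent → NegConstraint Ag (At 𝒯) → Set
  Complies 𝓑 emb τ κ =
    ∀ τ₁ → τ₁ ⊑ τ →
    τ₁ ⊢ emb (agent κ) ∋ᵀ atom (inj₁ (lhs κ)) →
    τ₁ ⊢ᵀ atom (inj₁ (rhs κ))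
    where open Judgement 𝓑

-- Only terms of the types C_γ(B) cross blocks of the partition, so a term of
-- an original atomic type A held by α was assembled inside the block of α: its
-- head constructor is possessed there, and by (4) it is π_{αA}, applied to a
-- term of type C_α(A). Such a term can only be m_{αA}^{β₁⋯βₙ} applied to
-- witnesses of A and of every C_{βᵢ}(Bᵢ), where α ∋ A ⇒ Bᵢ ranges over the
-- constraints; the first argument of each of these witnesses makes Bᵢ derivable.
-- Agent equality is not decidable, so membership in the same block is only
-- available doubly negated; this suffices because Select drops a constraint
-- only under a negated equation.
module Submission where

open import Defs
open import Data.List using (List; []; _∷_; _++_; [_]; length)
open import Data.List.Membership.Propositional using (_∈_)
open import Data.List.Relation.Unary.Any using (here; there)
open import Data.List.Relation.Unary.All as All using (All; []; _∷_)
open import Data.List.Relation.Unary.All.Properties using (++⁺)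
open import Data.List.Properties using (++-assoc; ++-identityʳ)
open import Data.Vec as Vec using (Vec)
open import Data.Product using (∃; ∃₂; Σ; _×_; _,_)
open import Data.Sum using (_⊎_; inj₁; inj₂)
open import Data.Empty using (⊥-elim)
open import Relation.Nullary using (¬_)
open import Relation.Nullary.Negation using (¬¬-map)
open import Relation.Binary.PropositionalEquality using (_≡_; _≢_; refl; sym; trans; subst)

rhs∈-Select : {Ag At : Set} {α : Ag} {A : At} {ℂ : List (NegConstraint Ag At)}
              {Bs : List At} {κ : NegConstraint Ag At} →
              Select α A ℂ Bs → κ ∈ ℂ → ¬ ¬ (agent κ ≡ α × lhs κ ≡ A) → rhs κ ∈ Bs
rhs∈-Select (keep _)    (here refl) _       = here refl
rhs∈-Select (keep sel)   (there κ∈)  matches = there (rhs∈-Select sel κ∈ matches)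
rhs∈-Select (skip ¬m _)  (here refl) matches = ⊥-elim (matches ¬m)
rhs∈-Select (skip _ sel) (there κ∈)  matches = rhs∈-Select sel κ∈ matches

head : {S : TypeSystem} {T : Ty (At S)} → Tm S T → Con S
head (con c)   = c
head (app f _) = head f

target-head : {S : TypeSystem} {T : Ty (At S)} (u : Tm S T) →
              target (conTy S (head u)) ≡ target T
target-head (con c)   = refl
target-head (app f _) = target-head f

module _ {S : TypeSystem} {Agent : Set} (𝓑 : Architecture S Agent) where
  open Judgement 𝓑

  Held : Trace S Agent → {T : Ty (At S)} → Tm S T → Set
  Held τ u = ∃ λ δ → τ ⊢ δ ∋ u

  held-app⁻ : ∀ {τ γ A B} {f : Tm S (A ⇒ B)} {t : Tm S A} →
              τ ⊢ γ ∋ app f t → Held τ f × Held τ t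
  held-app⁻ (func ⊢f ⊢t) = (_ , ⊢f) , (_ , ⊢t)
  held-app⁻ (message₁ ⊢ft α≢β msg) with held-app⁻ ⊢ft
  ... | (δ , ⊢f) , (δ' , ⊢t) = (δ , message₂ ⊢ft α≢β msg ⊢f) , (δ' , message₂ ⊢ft α≢β msg ⊢t)
  held-app⁻ (message₂ ⊢s α≢β msg ⊢ft) with held-app⁻ ⊢ft
  ... | (δ , ⊢f) , (δ' , ⊢t) = (δ , message₂ ⊢s α≢β msg ⊢f) , (δ' , message₂ ⊢s α≢β msg ⊢t)

  head-possessed-in-block :
    {P : Set} (part : Agent → P) {Crossing : At S → Set} →
    (∀ β β' A → M 𝓑 β β' A → part β ≢ part β' → Crossing A) →
    ∀ {τ β T} {u : Tm S T} → τ ⊢ β ∋ u → ¬ Crossing (target T) →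
    ∃ λ β' → ¬ ¬ (part β' ≡ part β) × H 𝓑 β' (head u)
  head-possessed-in-block part crossing (init c∈H) _ = _ , (λ k → k refl) , c∈H
  head-possessed-in-block part crossing (message₁ {α = α} {β = β} {A = A} ⊢u _ msg) ¬cross
    with head-possessed-in-block part crossing ⊢u ¬cross
  ... | β' , same-block , possesses =
    β' , (λ k → same-block λ e → ¬cross (crossing α β A msg λ e' → k (trans e e'))) , possesses
  head-possessed-in-block part crossing (message₂ _ _ _ ⊢u) = head-possessed-in-block part crossing ⊢u
  head-possessed-in-block part crossing (func ⊢f _)         = head-possessed-in-block part crossing ⊢f

module _ (𝒯 : TypeSystem) (Ag : Set) (ℂ : List (NegConstraint Ag (At 𝒯))) where
  open Extended 𝒯 Ag ℂ

  target-liftTy : ∀ T → target (liftTy T) ≡ inj₁ (target T)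
  target-liftTy (atom A) = refl
  target-liftTy (_ ⇒ B)  = target-liftTy B

  target-mArgs : ∀ Bs βs R → target (mArgs Bs βs R) ≡ target R
  target-mArgs []       Vec.[]         R = refl
  target-mArgs (_ ∷ Bs) (_ Vec.∷ βs) R = target-mArgs Bs βs R

  module _ {Agent : Set} (𝓑 : Architecture 𝒯ℂ Agent) where
    open Judgement 𝓑

    Derivable : Trace 𝒯ℂ Agent → At 𝒯 → Set
    Derivable τ A = τ ⊢ᵀ atom (inj₁ A)

    -- A held term whose type ends in C_γ(B) is m_{γB}^{β₁⋯βₙ}, either bare or
    -- applied to its first argument and the arguments for the constraints in
    -- supplied, with those for missing still missing.
    data MSpine (τ : Trace 𝒯ℂ Agent) (γ : Ag) (B : At 𝒯) (T : Ty AtC) : Set where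
      bare    : ∀ Bs → Select γ B ℂ Bs → (βs : Vec Ag (length Bs)) →
                T ≡ atom (inj₁ B) ⇒ mArgs Bs βs (Cty γ B) → MSpine τ γ B T
      applied : ∀ supplied missing → Select γ B ℂ (supplied ++ missing) →
                (βs : Vec Ag (length missing)) → T ≡ mArgs missing βs (Cty γ B) →
                All (Derivable τ) supplied → Derivable τ B → MSpine τ γ B T

    atomic-spine-derivable : ∀ {τ γ B X} → MSpine τ γ B (atom X) → Derivable τ B
    atomic-spine-derivable (bare _ _ _ ())
    atomic-spine-derivable (applied _ _ _ _ _ _ derivable-B) = derivable-B

    m-spine : ∀ {τ T γ B} (u : Tm 𝒯ℂ T) → Held 𝓑 τ u → target T ≡ inj₂ (γ , B) →
              MSpine τ γ B T
    m-spine (con (old c)) _ e with () ← trans (sym (target-liftTy (conTy 𝒯 c))) e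
    m-spine (con (m γ B Bs sel βs)) _ e with refl ← trans (sym (target-mArgs Bs βs (Cty γ B))) e =
      bare Bs sel βs refl
    m-spine (con (π _ _)) _ ()
    m-spine (app f t) (_ , ⊢ft) e with held-app⁻ 𝓑 ⊢ft
    ... | held-f , held-t@(δ , ⊢t) with m-spine f held-f e
    ... | bare Bs sel βs refl = applied [] Bs sel βs refl [] (δ , t , ⊢t)
    ... | applied supplied [] _ Vec.[] () _ _
    ... | applied supplied (B' ∷ missing) sel (_ Vec.∷ βs) refl derivable derivable-B =
      applied (supplied ++ [ B' ]) missing
              (subst (Select _ _ ℂ) (sym (++-assoc supplied [ B' ] missing)) sel) βs refl
              (++⁺ derivable (atomic-spine-derivable (m-spine t held-t refl) ∷ []))
              derivable-B

    C-witnesses : ∀ {τ γ B} (s : Tm 𝒯ℂ (Cty γ B)) → Held 𝓑 τ s →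
                  ∃ λ Bs → Select γ B ℂ Bs × All (Derivable τ) Bs
    C-witnesses s held with m-spine s held refl
    ... | bare _ _ _ ()
    ... | applied supplied [] sel Vec.[] refl derivable _ =
      supplied , subst (Select _ _ ℂ) (++-identityʳ supplied) sel , derivable
    ... | applied _ (_ ∷ _) _ (_ Vec.∷ _) () _ _

    π-argument : ∀ {τ T α A} (u : Tm 𝒯ℂ T) → Held 𝓑 τ u → head u ≡ π α A →
                 T ≡ Cty α A ⇒ atom (inj₁ A) ⊎
                 (T ≡ atom (inj₁ A) × Σ (Tm 𝒯ℂ (Cty α A)) (Held 𝓑 τ))
    π-argument (con _) _ refl = inj₁ refl
    π-argument (app f s) (_ , ⊢fs) head≡π with held-app⁻ 𝓑 ⊢fs
    ... | held-f , held-s with π-argument f held-f head≡π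
    ... | inj₁ refl       = inj₂ (refl , s , held-s)
    ... | inj₂ (() , _)

    π-headed-witnesses : ∀ {τ α A} (u : Tm 𝒯ℂ (atom (inj₁ A))) → Held 𝓑 τ u →
                         ¬ ¬ (head u ≡ π α A) →
                         ∃₂ λ γ Bs → ¬ ¬ (α ≡ γ) × Select γ A ℂ Bs × All (Derivable τ) Bs
    π-headed-witnesses u held head≈π with head u in eq | target-head u
    ... | old _ | _ = ⊥-elim (head≈π λ ())
    ... | m γ B Bs _ βs | e with () ← trans (sym (target-mArgs Bs βs (Cty γ B))) e
    ... | π γ A | _ with π-argument u held eq
    ... | inj₁ ()
    ... | inj₂ (refl , s , held-s) with C-witnesses s held-s
    ... | Bs , sel , derivable = γ , Bs , ¬¬-map (λ { refl → refl }) head≈π , sel , derivable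

theorem1 : (𝒯 : TypeSystem) (Ag : Set) (ℂ : List (NegConstraint Ag (At 𝒯))) →
    let open Extended 𝒯 Ag ℂ in
    (Ag' : Set) (𝓑 : Architecture 𝒯ℂ Ag') (emb : Ag → Ag') (part : Ag' → Ag) →
    (∀ α → part (emb α) ≡ α) →
    (∀ β β' A → M 𝓑 β β' A → part β ≢ part β' → ∃ λ γ → ∃ λ B → A ≡ inj₂ (γ , B)) →
    (∀ α A β → H 𝓑 β (π α A) → part β ≡ α) →
    (∀ κ → κ ∈ ℂ → ∀ β → part β ≡ agent κ → ∀ c → H 𝓑 β c →
      target (conTyC c) ≡ inj₁ (lhs κ) → c ≡ π (agent κ) (lhs κ)) →
    ∀ τ → Judgement.Valid 𝓑 τ → ∀ κ → κ ∈ ℂ → Complies 𝓑 emb τ κ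
theorem1 𝒯 Ag ℂ Ag' 𝓑 emb part part∘emb crossing _ only-π _ _ κ κ∈ℂ τ₁ _ (t , ⊢t)
  with head-possessed-in-block 𝓑 part crossing ⊢t (λ { (_ , _ , ()) })
... | β , same-block , possesses
  with π-headed-witnesses 𝒯 Ag ℂ 𝓑 t (_ , ⊢t)
         (¬¬-map (λ e → only-π κ κ∈ℂ β (trans e (part∘emb _)) _ possesses (target-head t))
                 same-block)
... | γ , _ , agent≈γ , sel , derivable =
  All.lookup derivable (rhs∈-Select sel κ∈ℂ (¬¬-map (_, refl) agent≈γ))
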